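{- Let $M$ be a real symmetric $3\times 3$ matrix. The following are equivalent: (1) $M$ has symmetric Barvinok rank at most $2$; (2) the deficiency graph of $M$ is $2$-colorable; (3) $M$ is tropically singular and $M_{ii}+M_{jj}\le 2M_{ij}$ for all $1\le i,j\le 3$.
   Context: For $v\in\mathbb{R}^3$, $v^T\odot v$ is the symmetric matrix with entries $v_i+v_j$. The symmetric Barvinok rank of $M$ is the least $r$ such that $M$ is the entrywise minimum of $r$ matrices $v^T\odot v$ (or $\infty$). The deficiency graph of $M$ has as vertices the entries of the symmetric matrix, i.e. the unordered pairs $\{i,j\}$ with $i,j\in[3]$ (possibly $i=j$); for all $i\ne k$ and $j\ne l$ with $M_{ij}+M_{kl}<M_{il}+M_{kj}$, it has an edge between $\{i,j\}$ and $\{k,l\}$ (a loop if these coincide). A graph is $2$-colorable if its vertices can be colored with 2 colors with no edge (in particular no loop) monochromatic. $M$ is tropically singular if the minimum of $\sum_{i=1}^3 M_{i\sigma(i)}$ over permutations $\sigma$ of $[3]$ is attained by at least two permutations. -}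

module Defs where

open import Data.Nat using (ℕ; zero; suc) renaming (_≤_ to _≤ℕ_)
open import Data.Fin using (Fin; zero; suc)
open import Data.Bool using (Bool)
open import Data.Product using (Σ; ∃; _×_; _,_)
open import Data.Sum using (_⊎_; inj₁; inj₂)
open import Relation.Nullary using (¬_)
open import Relation.Binary.PropositionalEquality using (_≡_)
open import Relation.Binary.Structures using (IsTotalOrder)
open import Algebra.Structures using (IsCommutativeRing)
open import Data.Fin.Permutation using (Permutation′; _⟨$⟩ʳ_)

-- The real numbers, axiomatised as a complete ordered field
-- (this characterises ℝ up to isomorphism).
record RealField : Set₁ where
  infixl 6 _+_
  infixl 7 _*_
  infix 4 _≤_
  field
    Carrier : Set
    0# 1# : Carrier
    _+_ _*_ : Carrier → Carrier → Carrier
    -_ : Carrier → Carrier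
    _≤_ : Carrier → Carrier → Set
    isCommutativeRing : IsCommutativeRing _≡_ _+_ _*_ -_ 0# 1#
    0≢1 : ¬ (0# ≡ 1#)
    inverse : ∀ x → ¬ (x ≡ 0#) → Σ Carrier (λ y → x * y ≡ 1#)
    isTotalOrder : IsTotalOrder _≡_ _≤_
    +-mono-≤ : ∀ {x y} z → x ≤ y → x + z ≤ y + z
    *-nonneg : ∀ {x y} → 0# ≤ x → 0# ≤ y → 0# ≤ x * y
    complete : (P : Carrier → Set) → Σ Carrier P →
               Σ Carrier (λ b → ∀ x → P x → x ≤ b) →
               Σ Carrier (λ s → (∀ x → P x → x ≤ s) ×
                                (∀ b → (∀ x → P x → x ≤ b) → s ≤ b))

  open IsTotalOrder isTotalOrder public using (total)

  infix 4 _<_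
  _<_ : Carrier → Carrier → Set
  x < y = x ≤ y × ¬ (x ≡ y)

  min : Carrier → Carrier → Carrier
  min x y with total x y
  ... | inj₁ _ = x
  ... | inj₂ _ = y

  minOver : (n : ℕ) → (Fin (suc n) → Carrier) → Carrier
  minOver zero f = f zero
  minOver (suc n) f = min (f zero) (minOver n (λ i → f (suc i)))

module _ (R : RealField) where
  open RealField R

  Matrix3 : Set
  Matrix3 = Fin 3 → Fin 3 → Carrier

  Vec3 : Set
  Vec3 = Fin 3 → Carrier

  IsSymmetric : Matrix3 → Set
  IsSymmetric M = ∀ i j → M i j ≡ M j i

  odot : Vec3 → Matrix3
  odot v i j = v i + v j

  IsMinOfOdots : Matrix3 → (k : ℕ) → (Fin (suc k) → Vec3) → Set
  IsMinOfOdots M k vs = ∀ i j → M i j ≡ minOver k (λ t → odot (vs t) i j)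

  SymBarvinokRankAtMost : Matrix3 → ℕ → Set
  SymBarvinokRankAtMost M r =
    Σ ℕ (λ k → suc k ≤ℕ r × Σ (Fin (suc k) → Vec3) (λ vs → IsMinOfOdots M k vs))

  -- edge relation of the deficiency graph (vertices = unordered pairs,
  -- represented by ordered pairs (i , j) up to symmetry)
  DeficiencyEdge : Matrix3 → Fin 3 → Fin 3 → Fin 3 → Fin 3 → Set
  DeficiencyEdge M i j k l =
    ¬ (i ≡ k) × ¬ (j ≡ l) × (M i j + M k l < M i l + M k j)

  -- a 2-colouring of the unordered pairs {i,j} such that no edge
  -- (and in particular no loop) is monochromatic
  DeficiencyGraph2Colorable : Matrix3 → Set
  DeficiencyGraph2Colorable M =
    Σ (Fin 3 → Fin 3 → Bool) (λ c →
      (∀ i j → c i j ≡ c j i) ×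
      (∀ i j k l → DeficiencyEdge M i j k l → ¬ (c i j ≡ c k l)))

  permSum : Matrix3 → Permutation′ 3 → Carrier
  permSum M σ = M zero (σ ⟨$⟩ʳ zero) + M (suc zero) (σ ⟨$⟩ʳ suc zero)
                  + M (suc (suc zero)) (σ ⟨$⟩ʳ suc (suc zero))

  AttainsMin : Matrix3 → Permutation′ 3 → Set
  AttainsMin M σ = ∀ ρ → permSum M σ ≤ permSum M ρ

  TropicallySingular : Matrix3 → Set
  TropicallySingular M =
    Σ (Permutation′ 3) (λ σ → Σ (Permutation′ 3) (λ τ →
      Σ (Fin 3) (λ i → ¬ (σ ⟨$⟩ʳ i ≡ τ ⟨$⟩ʳ i)) × AttainsMin M σ × AttainsMin M τ))

  DiagCondition : Matrix3 → Set
  DiagCondition M = ∀ i j → M i i + M j j ≤ M i j + M i j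

module Submission where

-- Call an off-diagonal pair i ≠ j tight if 2 M_ij ≤ M_ii + M_jj.  The proof goes
-- through the intermediate condition "(3') the diagonal condition holds and M has
-- a tight pair":
-- * (1) ⇒ (2): colour the entry {i,j} by which of the two rank-one terms attains
--   M_ij; two entries attained by the same term v⊙v carry no deficiency edge.
-- * (2) ⇒ (3'): loops {i,j}–{j,i} must be absent, which is the diagonal condition,
--   and two of the three diagonal entries share a colour, giving a tight pair.
-- * (3') ⇒ (1): after relabelling the tight pair to {0,1}, an explicit pair of
--   vectors v, w with M = min(v⊙v, w⊙w) is written down.
-- * (3') ⇔ (3): summing 2 M_{iρ(i)} ≥ M_ii + M_{ρ(i)ρ(i)} over i shows that under
--   the diagonal condition the identity is a minimal permutation, and a permutation
--   is minimal iff each of these inequalities is an equality; a transposition of a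
--   tight pair is therefore a second minimal permutation, and conversely.

open import Defs
open import Data.Nat using (ℕ; zero; suc; s≤s; z≤n)
open import Data.Fin using (Fin; zero; suc)
open import Data.Fin.Patterns using (0F; 1F; 2F)
open import Data.Fin.Properties using (_≟_; pigeonhole; <⇒≢; 2↔Bool)
open import Data.Fin.Permutation
  using (Permutation′; _⟨$⟩ʳ_; _⟨$⟩ˡ_; inverseʳ; transpose; _∘ₚ_)
import Data.Fin.Permutation as Perm
open import Data.Bool using (Bool; true; false)
open import Data.Product using (Σ; _×_; _,_; proj₁; proj₂)
open import Data.Sum using (_⊎_; inj₁; inj₂)
open import Data.Empty using (⊥-elim)
open import Function.Bundles using (_⇔_; mk⇔; Inverse)
open import Relation.Nullary using (¬_; yes; no)
open import Relation.Nullary.Decidable using (dec-true; dec-false)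
open import Relation.Binary.PropositionalEquality
open import Relation.Binary.Bundles using (Poset)
open import Relation.Binary.Structures using (IsTotalOrder)
import Relation.Binary.Reasoning.PartialOrder as PosetReasoning
open import Algebra.Structures using (IsCommutativeRing)
open import Algebra.Bundles using (CommutativeRing)
import Algebra.Properties.Ring as RingProperties
import Algebra.Properties.CommutativeMonoid.Sum as Sum
open import Algebra.Properties.CommutativeSemigroup using (interchange)

module OrderedFieldFacts (R : RealField) where
  open RealField R
  open IsCommutativeRing isCommutativeRing public
    using (+-comm; +-assoc; +-identityˡ; +-identityʳ; -‿inverseʳ;
           distribˡ; distribʳ; *-identityˡ; *-identityʳ)
  open IsTotalOrder isTotalOrder public
    using () renaming (refl to ≤-refl; trans to ≤-trans; antisym to ≤-antisym; reflexive to ≤-reflexive)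

  ≤-poset : Poset _ _ _
  ≤-poset = record { isPartialOrder = IsTotalOrder.isPartialOrder isTotalOrder }

  module ≤-Reasoning = PosetReasoning ≤-poset

  commutativeRing : CommutativeRing _ _
  commutativeRing = record { isCommutativeRing = isCommutativeRing }

  open RingProperties (CommutativeRing.ring commutativeRing) public
    using (//-rightDividesˡ; //-rightDividesʳ; -‿distribˡ-*; -‿involutive)

  +-interchange : ∀ a b c d → (a + b) + (c + d) ≡ (a + c) + (b + d)
  +-interchange = interchange (CommutativeRing.+-commutativeSemigroup commutativeRing)

  +-mono₂-≤ : ∀ {a b c d} → a ≤ b → c ≤ d → a + c ≤ b + d
  +-mono₂-≤ {a} {b} {c} {d} a≤b c≤d = ≤-trans (+-mono-≤ c a≤b)
    (subst₂ _≤_ (+-comm c b) (+-comm d b) (+-mono-≤ b c≤d))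

  +-cancelʳ-≤ : ∀ {a b} c → a + c ≤ b + c → a ≤ b
  +-cancelʳ-≤ {a} {b} c a+c≤b+c =
    subst₂ _≤_ (//-rightDividesʳ c a) (//-rightDividesʳ c b) (+-mono-≤ (- c) a+c≤b+c)

  +-cancelˡ-≤ : ∀ {a b} c → c + a ≤ c + b → a ≤ b
  +-cancelˡ-≤ {a} {b} c c+a≤c+b = +-cancelʳ-≤ c (subst₂ _≤_ (+-comm c a) (+-comm c b) c+a≤c+b)

  -- If 1 ≤ 0 then 0 ≤ -1, hence 0 ≤ (-1)(-1) = 1.
  0≤1 : 0# ≤ 1#
  0≤1 with total 0# 1#
  ... | inj₁ 0≤1 = 0≤1
  ... | inj₂ 1≤0 = subst (0# ≤_) -1*-1≡1 (*-nonneg 0≤-1 0≤-1)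
    where
    0≤-1 : 0# ≤ - 1#
    0≤-1 = subst₂ _≤_ (-‿inverseʳ 1#) (+-identityˡ (- 1#)) (+-mono-≤ (- 1#) 1≤0)
    -1*-1≡1 : - 1# * - 1# ≡ 1#
    -1*-1≡1 = trans (sym (-‿distribˡ-* 1# (- 1#)))
                    (trans (cong -_ (*-identityˡ (- 1#))) (-‿involutive 1#))

  -- Completeness makes ≤ stable under double negation.  The set {x | ¬¬ x ≤ 0}
  -- contains 0, is bounded by 1 and is closed under adding any d with ¬¬ d ≤ 0,
  -- so its supremum s satisfies s + d ≤ s, i.e. d ≤ 0.
  ≤0-stable : ∀ d → ¬ ¬ (d ≤ 0#) → d ≤ 0#
  ≤0-stable d ¬¬d≤0 = +-cancelˡ-≤ s (subst (s + d ≤_) (sym (+-identityʳ s)) s+d≤s)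
    where
    P : Carrier → Set
    P x = ¬ ¬ (x ≤ 0#)
    P≤1 : ∀ x → P x → x ≤ 1#
    P≤1 x Px with total x 1#
    ... | inj₁ x≤1 = x≤1
    ... | inj₂ 1≤x = ⊥-elim (Px λ x≤0 → 0≢1 (≤-antisym 0≤1 (≤-trans 1≤x x≤0)))
    sup = complete P (0# , λ ¬0≤0 → ¬0≤0 ≤-refl) (1# , P≤1)
    s = proj₁ sup
    P-closed : ∀ x → P x → P (x + d)
    P-closed x Px ¬x+d≤0 = Px λ x≤0 → ¬¬d≤0 λ d≤0 →
      ¬x+d≤0 (subst (x + d ≤_) (+-identityʳ 0#) (+-mono₂-≤ x≤0 d≤0))
    s≤s-d : s ≤ s + - d
    s≤s-d = proj₂ (proj₂ sup) (s + - d) λ x Px →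
      subst (_≤ s + - d) (//-rightDividesʳ d x)
        (+-mono-≤ (- d) (proj₁ (proj₂ sup) (x + d) (P-closed x Px)))
    s+d≤s : s + d ≤ s
    s+d≤s = subst (s + d ≤_) (//-rightDividesˡ d s) (+-mono-≤ d s≤s-d)

  ≤-stable : ∀ {a b} → ¬ ¬ (a ≤ b) → a ≤ b
  ≤-stable {a} {b} ¬¬a≤b = subst₂ _≤_ (//-rightDividesˡ b a) (+-identityˡ b)
    (+-mono-≤ b (≤0-stable (a + - b) λ ¬a-b≤0 → ¬¬a≤b λ a≤b →
      ¬a-b≤0 (subst (a + - b ≤_) (-‿inverseʳ b) (+-mono-≤ (- b) a≤b))))

  ≮⇒≥ : ∀ {a b} → ¬ (a < b) → b ≤ a
  ≮⇒≥ {a} {b} a≮b = ≤-stable λ b≰a → a≮b (≰⇒≥ b≰a , λ a≡b → b≰a (≤-reflexive (sym a≡b)))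
    where
    ≰⇒≥ : ¬ (b ≤ a) → a ≤ b
    ≰⇒≥ b≰a with total a b
    ... | inj₁ a≤b = a≤b
    ... | inj₂ b≤a = ⊥-elim (b≰a b≤a)

  <⇒≱ : ∀ {a b} → a < b → ¬ (b ≤ a)
  <⇒≱ (a≤b , a≢b) b≤a = a≢b (≤-antisym a≤b b≤a)

  2# : Carrier
  2# = 1# + 1#

  2≢0 : ¬ (2# ≡ 0#)
  2≢0 2≡0 = 0≢1 (≤-antisym 0≤1 (subst (1# ≤_) 2≡0 1≤2))
    where
    1≤2 : 1# ≤ 2#
    1≤2 = subst (_≤ 2#) (+-identityˡ 1#) (+-mono-≤ 1# 0≤1)

  half : Carrier → Carrier
  half x = x * proj₁ (inverse 2# 2≢0)

  half+half : ∀ x → half x + half x ≡ x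
  half+half x = begin
    x * ½ + x * ½     ≡⟨ distribˡ x ½ ½ ⟨
    x * (½ + ½)       ≡⟨ cong (x *_) ½+½≡2*½ ⟩
    x * (2# * ½)      ≡⟨ cong (x *_) (proj₂ (inverse 2# 2≢0)) ⟩
    x * 1#            ≡⟨ *-identityʳ x ⟩
    x                 ∎
    where
    open ≡-Reasoning
    ½ = proj₁ (inverse 2# 2≢0)
    ½+½≡2*½ : ½ + ½ ≡ 2# * ½
    ½+½≡2*½ = sym (trans (distribʳ ½ 1# 1#) (cong₂ _+_ (*-identityˡ ½) (*-identityˡ ½)))

  double-injective : ∀ {u v} → u + u ≡ v + v → u ≡ v
  double-injective {u} {v} 2u≡2v = begin
    u                 ≡⟨ half+half u ⟨
    half u + half u   ≡⟨ distribʳ _ u u ⟨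
    half (u + u)      ≡⟨ cong half 2u≡2v ⟩
    half (v + v)      ≡⟨ distribʳ _ v v ⟩
    half v + half v   ≡⟨ half+half v ⟩
    v                 ∎
    where open ≡-Reasoning

  double-reflects-≤ : ∀ {u v} → u + u ≤ v + v → u ≤ v
  double-reflects-≤ {u} {v} 2u≤2v with total u v
  ... | inj₁ u≤v = u≤v
  ... | inj₂ v≤u = ≤-reflexive (double-injective (≤-antisym 2u≤2v (+-mono₂-≤ v≤u v≤u)))

  min≤ˡ : ∀ p q → min p q ≤ p
  min≤ˡ p q with total p q
  ... | inj₁ _   = ≤-refl
  ... | inj₂ q≤p = q≤p

  min≤ʳ : ∀ p q → min p q ≤ q
  min≤ʳ p q with total p q
  ... | inj₁ p≤q = p≤q
  ... | inj₂ _   = ≤-refl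

  min-selectˡ : ∀ {p q} → p ≤ q → min p q ≡ p
  min-selectˡ {p} {q} p≤q with total p q
  ... | inj₁ _   = refl
  ... | inj₂ q≤p = ≤-antisym q≤p p≤q

  min-selectʳ : ∀ {p q} → q ≤ p → min p q ≡ q
  min-selectʳ {p} {q} q≤p with total p q
  ... | inj₁ p≤q = ≤-antisym p≤q q≤p
  ... | inj₂ _   = refl

  min-idem : ∀ p → min p p ≡ p
  min-idem p = min-selectˡ ≤-refl

  max : Carrier → Carrier → Carrier
  max p q with total p q
  ... | inj₁ _ = q
  ... | inj₂ _ = p

  ≤maxˡ : ∀ p q → p ≤ max p q
  ≤maxˡ p q with total p q
  ... | inj₁ p≤q = p≤q
  ... | inj₂ _   = ≤-refl

  ≤maxʳ : ∀ p q → q ≤ max p q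
  ≤maxʳ p q with total p q
  ... | inj₁ _   = ≤-refl
  ... | inj₂ q≤p = q≤p

module OrderedSums (R : RealField) where
  open RealField R
  open OrderedFieldFacts R
  open Sum (CommutativeRing.+-commutativeMonoid commutativeRing) public
    using (sum; ∑-distrib-+; ∑-permute)

  ∑-mono-≤ : ∀ {n} {f g : Fin n → Carrier} → (∀ i → f i ≤ g i) → sum f ≤ sum g
  ∑-mono-≤ {zero} f≤g = ≤-refl
  ∑-mono-≤ {suc n}  f≤g = +-mono₂-≤ (f≤g zero) (∑-mono-≤ (λ i → f≤g (suc i)))

  ∑-tight : ∀ {n} {f g : Fin n → Carrier} → (∀ i → f i ≤ g i) →
            sum g ≤ sum f → ∀ i → g i ≤ f i
  ∑-tight {suc n} {f} {g} f≤g ∑g≤∑f zero = +-cancelʳ-≤ (sum (λ i → g (suc i)))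
    (≤-trans ∑g≤∑f (+-mono₂-≤ ≤-refl (∑-mono-≤ (λ i → f≤g (suc i)))))
  ∑-tight {suc n} {f} {g} f≤g ∑g≤∑f (suc i) = ∑-tight (λ i → f≤g (suc i))
    (+-cancelˡ-≤ (g zero) (≤-trans ∑g≤∑f (+-mono-≤ (sum (λ i → f (suc i))) (f≤g zero))))
    i

module TranspositionFacts {n : ℕ} where
  transpose-maps-i : (i j : Fin n) → transpose i j ⟨$⟩ʳ i ≡ j
  transpose-maps-i i j rewrite dec-true (i ≟ i) refl = refl

  transpose-fixes : {i j k : Fin n} → ¬ k ≡ i → ¬ k ≡ j → transpose i j ⟨$⟩ʳ k ≡ k
  transpose-fixes {i} {j} {k} k≢i k≢j rewrite dec-false (k ≟ i) k≢i | dec-false (k ≟ j) k≢j = refl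

  transpose-cases : (i j k : Fin n) →
    (k ≡ i × transpose i j ⟨$⟩ʳ k ≡ j) ⊎ (k ≡ j × transpose i j ⟨$⟩ʳ k ≡ i) ⊎ transpose i j ⟨$⟩ʳ k ≡ k
  transpose-cases i j k with k ≟ i
  ... | yes k≡i = inj₁ (k≡i , refl)
  ... | no _ with k ≟ j
  ...   | yes k≡j = inj₂ (inj₁ (k≡j , refl))
  ...   | no _    = inj₂ (inj₂ refl)

-- Any two distinct points can be moved to positions 0 and 1 by a permutation:
-- first swap 0 with i, then swap 1 with the preimage of j (which is not 0).
placeAt01 : ∀ {n} (i j : Fin (suc (suc n))) → ¬ i ≡ j →
            Σ (Permutation′ (suc (suc n))) λ π → π ⟨$⟩ʳ 0F ≡ i × π ⟨$⟩ʳ 1F ≡ j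
placeAt01 i j i≢j = π , π0≡i , π1≡j
  where
  open TranspositionFacts
  τ = transpose 0F i
  j′ = τ ⟨$⟩ˡ j
  π = transpose 1F j′ ∘ₚ τ
  0≢j′ : ¬ 0F ≡ j′
  0≢j′ 0≡j′ = i≢j (trans (sym (transpose-maps-i 0F i)) (trans (cong (τ ⟨$⟩ʳ_) 0≡j′) (inverseʳ τ)))
  π0≡i : π ⟨$⟩ʳ 0F ≡ i
  π0≡i = trans (cong (τ ⟨$⟩ʳ_) (transpose-fixes {i = 1F} (λ ()) 0≢j′)) (transpose-maps-i 0F i)
  π1≡j : π ⟨$⟩ʳ 1F ≡ j
  π1≡j = trans (cong (τ ⟨$⟩ʳ_) (transpose-maps-i 1F j′)) (inverseʳ τ)

twoOfThreeAgree : (c : Fin 3 → Bool) → Σ (Fin 3) λ i → Σ (Fin 3) λ j → ¬ i ≡ j × c i ≡ c j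
twoOfThreeAgree c with pigeonhole (s≤s (s≤s (s≤s z≤n))) (λ i → Inverse.from 2↔Bool (c i))
... | i , j , i<j , same = i , j , <⇒≢ i<j , from-injective same
  where
  open Inverse 2↔Bool using (to; from; strictlyInverseˡ)
  from-injective : ∀ {b b′} → from b ≡ from b′ → b ≡ b′
  from-injective {b} {b′} eq = trans (sym (strictlyInverseˡ b)) (trans (cong to eq) (strictlyInverseˡ b′))

module SymmetricMatrices (R : RealField) where
  open RealField R
  open OrderedFieldFacts R
  open OrderedSums R
  open TranspositionFacts

  -- An off-diagonal pair {i,j} is tight if 2 M_ij ≤ M_ii + M_jj; under the
  -- diagonal condition this is the equality 2 M_ij = M_ii + M_jj.
  IsTightPair : Matrix3 R → Fin 3 → Fin 3 → Set
  IsTightPair M i j = M i j + M i j ≤ M i i + M j j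

  HasTightPair : Matrix3 R → Set
  HasTightPair M = Σ (Fin 3) λ i → Σ (Fin 3) λ j → ¬ i ≡ j × IsTightPair M i j

  tightPair-sym : ∀ {M : Matrix3 R} → IsSymmetric R M → ∀ {i j} → IsTightPair M i j → IsTightPair M j i
  tightPair-sym {M} symM {i} {j} tight =
    subst₂ _≤_ (cong₂ _+_ (symM i j) (symM i j)) (+-comm (M i i) (M j j)) tight

  -- M = min(v⊙v, w⊙w); rank ≤ 2 means exactly this (a single term can be doubled).
  IsMinOfTwo : Matrix3 R → Vec3 R → Vec3 R → Set
  IsMinOfTwo M v w = ∀ i j → M i j ≡ min (v i + v j) (w i + w j)

  rank≤2⇒minOfTwo : ∀ {M : Matrix3 R} → SymBarvinokRankAtMost R M 2 →
                    Σ (Vec3 R) λ v → Σ (Vec3 R) λ w → IsMinOfTwo M v w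
  rank≤2⇒minOfTwo (0 , _ , vs , M≡) = vs 0F , vs 0F , λ i j → trans (M≡ i j) (sym (min-idem _))
  rank≤2⇒minOfTwo (1 , _ , vs , M≡) = vs 0F , vs 1F , M≡
  rank≤2⇒minOfTwo (suc (suc _) , s≤s (s≤s ()) , _)

  minOfTwo⇒rank≤2 : ∀ {M : Matrix3 R} {v w : Vec3 R} → IsMinOfTwo M v w → SymBarvinokRankAtMost R M 2
  minOfTwo⇒rank≤2 {v = v} {w} M≡ = 1 , s≤s (s≤s z≤n) , (λ { 0F → v ; 1F → w }) , M≡

  -- If u⊙u dominates M and agrees with it at (i,j) and (k,l), there is no
  -- deficiency edge between them: the exchange sums of u⊙u coincide.
  agreementNoDeficit : ∀ {M : Matrix3 R} (u : Vec3 R) → (∀ i j → M i j ≤ u i + u j) →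
    ∀ {i j k l} → M i j ≡ u i + u j → M k l ≡ u k + u l → M i l + M k j ≤ M i j + M k l
  agreementNoDeficit {M} u M≤u {i} {j} {k} {l} Mij≡ Mkl≡ = begin
    M i l + M k j                ≤⟨ +-mono₂-≤ (M≤u i l) (M≤u k j) ⟩
    (u i + u l) + (u k + u j)    ≡⟨ +-interchange (u i) (u l) (u k) (u j) ⟩
    (u i + u k) + (u l + u j)    ≡⟨ cong ((u i + u k) +_) (+-comm (u l) (u j)) ⟩
    (u i + u k) + (u j + u l)    ≡⟨ +-interchange (u i) (u k) (u j) (u l) ⟩
    (u i + u j) + (u k + u l)    ≡⟨ cong₂ _+_ Mij≡ Mkl≡ ⟨
    M i j + M k l                ∎
    where open ≤-Reasoning

  firstIsMin : Carrier → Carrier → Bool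
  firstIsMin p q with total p q
  ... | inj₁ _ = true
  ... | inj₂ _ = false

  min-chosen : ∀ p q → (firstIsMin p q ≡ true  × min p q ≡ p)
                     ⊎ (firstIsMin p q ≡ false × min p q ≡ q)
  min-chosen p q with total p q
  ... | inj₁ _ = inj₁ (refl , refl)
  ... | inj₂ _ = inj₂ (refl , refl)

  -- (1) ⇒ (2): colour each entry by the term attaining it.
  minOfTwo⇒colourable : ∀ {M : Matrix3 R} {v w : Vec3 R} → IsMinOfTwo M v w → DeficiencyGraph2Colorable R M
  minOfTwo⇒colourable {M} {v} {w} M≡ = colour , colour-sym , noMonochromaticEdge
    where
    colour : Fin 3 → Fin 3 → Bool
    colour i j = firstIsMin (v i + v j) (w i + w j)

    colour-sym : ∀ i j → colour i j ≡ colour j i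
    colour-sym i j = cong₂ firstIsMin (+-comm (v i) (v j)) (+-comm (w i) (w j))

    term : Bool → Vec3 R
    term true  = v
    term false = w

    dominated : ∀ b i j → M i j ≤ term b i + term b j
    dominated true  i j = subst (_≤ v i + v j) (sym (M≡ i j)) (min≤ˡ _ _)
    dominated false i j = subst (_≤ w i + w j) (sym (M≡ i j)) (min≤ʳ _ _)

    attained : ∀ i j → M i j ≡ term (colour i j) i + term (colour i j) j
    attained i j with min-chosen (v i + v j) (w i + w j)
    ... | inj₁ (c≡true  , min≡) rewrite c≡true  = trans (M≡ i j) min≡
    ... | inj₂ (c≡false , min≡) rewrite c≡false = trans (M≡ i j) min≡

    noMonochromaticEdge : ∀ i j k l → DeficiencyEdge R M i j k l → ¬ colour i j ≡ colour k l
    noMonochromaticEdge i j k l (_ , _ , deficit) same = <⇒≱ deficit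
      (agreementNoDeficit (term (colour i j)) (dominated (colour i j)) (attained i j)
        (subst (λ b → M k l ≡ term b k + term b l) (sym same) (attained k l)))

  rank≤2⇒colourable : ∀ {M : Matrix3 R} → SymBarvinokRankAtMost R M 2 → DeficiencyGraph2Colorable R M
  rank≤2⇒colourable rank = minOfTwo⇒colourable (proj₂ (proj₂ (rank≤2⇒minOfTwo rank)))

  module _ {M : Matrix3 R} (symM : IsSymmetric R M) (C : DeficiencyGraph2Colorable R M) where
    private
      colour = proj₁ C
      colour-sym = proj₁ (proj₂ C)
      proper = proj₂ (proj₂ C)

    sameColour⇒noDeficit : ∀ {i j k l} → ¬ i ≡ k → ¬ j ≡ l → colour i j ≡ colour k l →
                           M i l + M k j ≤ M i j + M k l
    sameColour⇒noDeficit i≢k j≢l same = ≮⇒≥ λ deficit → proper _ _ _ _ (i≢k , j≢l , deficit) same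

    -- The vertices (i,j) and (j,i) coincide, so they span no edge (loop).
    colourable⇒diag : DiagCondition R M
    colourable⇒diag i j with i ≟ j
    ... | yes refl = ≤-refl
    ... | no i≢j = subst (λ t → M i i + M j j ≤ M i j + t) (symM j i)
      (sameColour⇒noDeficit i≢j (λ j≡i → i≢j (sym j≡i)) (colour-sym i j))

    -- Two diagonal entries (i,i), (j,j) share a colour, so the pair {i,j} is tight.
    colourable⇒tightPair : HasTightPair M
    colourable⇒tightPair with twoOfThreeAgree (λ i → colour i i)
    ... | i , j , i≢j , same = i , j , i≢j ,
      subst (λ t → M i j + t ≤ M i i + M j j) (symM j i) (sameColour⇒noDeficit i≢j i≢j same)

  -- Diagonal condition and tight pair {0,1} ⇒ (1), with the explicit vectors
  --   v = (a/2, b/2, max(y - a/2, z - b/2)),   w = (y - c/2, z - c/2, c/2)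
  -- where a, b, c are the diagonal entries, and x, y, z the entries 01, 02, 12.
  -- Then v⊙v attains the block {0,1}², w⊙w attains column and row 2.
  module TightPairConstruction {M : Matrix3 R} (symM : IsSymmetric R M) (diag : DiagCondition R M)
                               (tight01 : IsTightPair M 0F 1F) where
    a b c x y z : Carrier
    a = M 0F 0F
    b = M 1F 1F
    c = M 2F 2F
    x = M 0F 1F
    y = M 0F 2F
    z = M 1F 2F

    v w : Vec3 R
    v 0F = half a
    v 1F = half b
    v 2F = max (y + - half a) (z + - half b)
    w 0F = y + - half c
    w 1F = z + - half c
    w 2F = half c

    shift-double : ∀ {q p k} → q + (k + k) ≤ p + p → q ≤ (p + - k) + (p + - k)
    shift-double {q} {p} {k} q+2k≤2p =
      +-cancelʳ-≤ (k + k) (subst (q + (k + k) ≤_) (sym 2[p-k]+2k≡2p) q+2k≤2p)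
      where
      2[p-k]+2k≡2p : ((p + - k) + (p + - k)) + (k + k) ≡ p + p
      2[p-k]+2k≡2p = trans (+-interchange _ _ k k) (cong₂ _+_ (//-rightDividesˡ k p) (//-rightDividesˡ k p))

    ≤-add-diff : ∀ {p k t} → p + - k ≤ t → p ≤ k + t
    ≤-add-diff {p} {k} {t} p-k≤t =
      subst (_≤ k + t) (trans (+-comm k _) (//-rightDividesˡ k p)) (+-mono₂-≤ ≤-refl p-k≤t)

    -- The diagonal conditions for {0,2}, {1,2} with a diagonal entry split into halves.
    a≤2w0 : a ≤ w 0F + w 0F
    a≤2w0 = shift-double (subst (λ t → a + t ≤ y + y) (sym (half+half c)) (diag 0F 2F))

    b≤2w1 : b ≤ w 1F + w 1F
    b≤2w1 = shift-double (subst (λ t → b + t ≤ z + z) (sym (half+half c)) (diag 1F 2F))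

    c≤2v2 : c ≤ v 2F + v 2F
    c≤2v2 = ≤-trans
      (shift-double (subst (λ t → c + t ≤ y + y) (sym (half+half a)) (subst (_≤ y + y) (+-comm a c) (diag 0F 2F))))
      (+-mono₂-≤ (≤maxˡ _ _) (≤maxˡ _ _))

    -- Tightness of {0,1}: a + b = 2x, so x = a/2 + b/2.
    v0+v1≡x : v 0F + v 1F ≡ x
    v0+v1≡x = double-injective (begin
      (half a + half b) + (half a + half b)  ≡⟨ +-interchange _ _ _ _ ⟩
      (half a + half a) + (half b + half b)  ≡⟨ cong₂ _+_ (half+half a) (half+half b) ⟩
      a + b                                  ≡⟨ ≤-antisym (diag 0F 1F) tight01 ⟩
      x + x                                  ∎)
      where open ≡-Reasoning

    v0+v1≤w0+w1 : v 0F + v 1F ≤ w 0F + w 1F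
    v0+v1≤w0+w1 = double-reflects-≤ (subst₂ _≤_
      (trans (cong₂ _+_ (sym (half+half a)) (sym (half+half b))) (+-interchange _ _ _ _))
      (+-interchange _ _ _ _)
      (+-mono₂-≤ a≤2w0 b≤2w1))

    Entry : Fin 3 → Fin 3 → Set
    Entry i j = M i j ≡ min (v i + v j) (w i + w j)

    attainedByV : ∀ {i j} → M i j ≡ v i + v j → v i + v j ≤ w i + w j → Entry i j
    attainedByV Mij≡ v≤w = trans Mij≡ (sym (min-selectˡ v≤w))

    attainedByW : ∀ {i j} → M i j ≡ w i + w j → w i + w j ≤ v i + v j → Entry i j
    attainedByW Mij≡ w≤v = trans Mij≡ (sym (min-selectʳ w≤v))

    entry-sym : ∀ i j → Entry i j → Entry j i
    entry-sym i j Mij≡ = trans (symM j i) (trans Mij≡ (cong₂ min (+-comm (v i) (v j)) (+-comm (w i) (w j))))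

    minOfTwo : IsMinOfTwo M v w
    minOfTwo 0F 0F = attainedByV (sym (half+half a)) (subst (_≤ w 0F + w 0F) (sym (half+half a)) a≤2w0)
    minOfTwo 1F 1F = attainedByV (sym (half+half b)) (subst (_≤ w 1F + w 1F) (sym (half+half b)) b≤2w1)
    minOfTwo 2F 2F = attainedByW (sym (half+half c)) (subst (_≤ v 2F + v 2F) (sym (half+half c)) c≤2v2)
    minOfTwo 0F 1F = attainedByV (sym v0+v1≡x) v0+v1≤w0+w1
    minOfTwo 0F 2F = attainedByW (sym (//-rightDividesˡ (half c) y))
      (subst (_≤ v 0F + v 2F) (sym (//-rightDividesˡ (half c) y)) (≤-add-diff (≤maxˡ _ _)))
    minOfTwo 1F 2F = attainedByW (sym (//-rightDividesˡ (half c) z))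
      (subst (_≤ v 1F + v 2F) (sym (//-rightDividesˡ (half c) z)) (≤-add-diff (≤maxʳ _ _)))
    minOfTwo 1F 0F = entry-sym 0F 1F (minOfTwo 0F 1F)
    minOfTwo 2F 0F = entry-sym 0F 2F (minOfTwo 0F 2F)
    minOfTwo 2F 1F = entry-sym 1F 2F (minOfTwo 1F 2F)

  relabel : Matrix3 R → Permutation′ 3 → Matrix3 R
  relabel M π i j = M (π ⟨$⟩ʳ i) (π ⟨$⟩ʳ j)

  rank-relabel : ∀ {M : Matrix3 R} {r : ℕ} (π : Permutation′ 3) →
                 SymBarvinokRankAtMost R (relabel M π) r → SymBarvinokRankAtMost R M r
  rank-relabel {M} π (k , k<r , vs , M≡) = k , k<r , (λ t i → vs t (π ⟨$⟩ˡ i)) ,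
    λ i j → trans (cong₂ M (sym (inverseʳ π)) (sym (inverseʳ π))) (M≡ (π ⟨$⟩ˡ i) (π ⟨$⟩ˡ j))

  tightPair⇒rank≤2 : ∀ {M : Matrix3 R} → IsSymmetric R M → DiagCondition R M → HasTightPair M →
                     SymBarvinokRankAtMost R M 2
  tightPair⇒rank≤2 {M} symM diag (i , j , i≢j , tight) with placeAt01 i j i≢j
  ... | π , refl , refl = rank-relabel π (minOfTwo⇒rank≤2 (TightPairConstruction.minOfTwo
      (λ p q → symM (π ⟨$⟩ʳ p) (π ⟨$⟩ʳ q)) (λ p q → diag (π ⟨$⟩ʳ p) (π ⟨$⟩ʳ q)) tight))

  colourable⇒rank≤2 : ∀ {M : Matrix3 R} → IsSymmetric R M → DeficiencyGraph2Colorable R M → SymBarvinokRankAtMost R M 2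
  colourable⇒rank≤2 symM C = tightPair⇒rank≤2 symM (colourable⇒diag symM C) (colourable⇒tightPair symM C)

  -- Tropical singularity.  Comparing Σ_i 2 M_{iρ(i)} = 2·permSum ρ with
  -- Σ_i (M_ii + M_{ρ(i)ρ(i)}) = 2·trace shows which permutations are minimal.
  trace : Matrix3 R → Carrier
  trace M = sum (λ i → M i i)

  module _ {M : Matrix3 R} where
    permSum-as-sum : ∀ ρ → permSum R M ρ ≡ sum (λ i → M i (ρ ⟨$⟩ʳ i))
    permSum-as-sum ρ = trans (+-assoc _ _ _)
      (cong (M 0F (ρ ⟨$⟩ʳ 0F) +_) (cong (M 1F (ρ ⟨$⟩ʳ 1F) +_) (sym (+-identityʳ _))))

    permSum-id : permSum R M Perm.id ≡ trace M
    permSum-id = permSum-as-sum Perm.id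

    ∑-diagonalPairs : ∀ ρ → sum (λ i → M i i + M (ρ ⟨$⟩ʳ i) (ρ ⟨$⟩ʳ i)) ≡ trace M + trace M
    ∑-diagonalPairs ρ = trans (∑-distrib-+ (λ i → M i i) (λ i → M (ρ ⟨$⟩ʳ i) (ρ ⟨$⟩ʳ i)))
      (cong (trace M +_) (sym (∑-permute (λ i → M i i) ρ)))

    ∑-doubledEntries : ∀ ρ → sum (λ i → M i (ρ ⟨$⟩ʳ i) + M i (ρ ⟨$⟩ʳ i)) ≡ permSum R M ρ + permSum R M ρ
    ∑-doubledEntries ρ = trans (∑-distrib-+ (λ i → M i (ρ ⟨$⟩ʳ i)) (λ i → M i (ρ ⟨$⟩ʳ i)))
      (sym (cong₂ _+_ (permSum-as-sum ρ) (permSum-as-sum ρ)))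

    trace≤permSum : DiagCondition R M → ∀ ρ → trace M ≤ permSum R M ρ
    trace≤permSum diag ρ = double-reflects-≤ (subst₂ _≤_ (∑-diagonalPairs ρ) (∑-doubledEntries ρ)
      (∑-mono-≤ (λ i → diag i (ρ ⟨$⟩ʳ i))))

    minimal⇒tight : DiagCondition R M → ∀ ρ → permSum R M ρ ≤ trace M → ∀ i → IsTightPair M i (ρ ⟨$⟩ʳ i)
    minimal⇒tight diag ρ ρ≤tr = ∑-tight (λ i → diag i (ρ ⟨$⟩ʳ i))
      (subst₂ _≤_ (sym (∑-doubledEntries ρ)) (sym (∑-diagonalPairs ρ)) (+-mono₂-≤ ρ≤tr ρ≤tr))

    tight⇒minimal : ∀ ρ → (∀ i → IsTightPair M i (ρ ⟨$⟩ʳ i)) → permSum R M ρ ≤ trace M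
    tight⇒minimal ρ tight = double-reflects-≤ (subst₂ _≤_ (∑-doubledEntries ρ) (∑-diagonalPairs ρ) (∑-mono-≤ tight))

    attainsMin⇒≤trace : ∀ ρ → AttainsMin R M ρ → permSum R M ρ ≤ trace M
    attainsMin⇒≤trace ρ ρ-min = ≤-trans (ρ-min Perm.id) (≤-reflexive permSum-id)

    ≤trace⇒attainsMin : DiagCondition R M → ∀ ρ → permSum R M ρ ≤ trace M → AttainsMin R M ρ
    ≤trace⇒attainsMin diag ρ ρ≤tr σ = ≤-trans ρ≤tr (trace≤permSum diag σ)

    movedByMinimal⇒tightPair : DiagCondition R M → ∀ ρ i → ¬ ρ ⟨$⟩ʳ i ≡ i → AttainsMin R M ρ → HasTightPair M
    movedByMinimal⇒tightPair diag ρ i ρi≢i ρ-min =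
      i , ρ ⟨$⟩ʳ i , (λ i≡ρi → ρi≢i (sym i≡ρi)) , minimal⇒tight diag ρ (attainsMin⇒≤trace ρ ρ-min) i

    -- Of two minimal permutations differing at i, one moves i.
    singular⇒tightPair : DiagCondition R M → TropicallySingular R M → HasTightPair M
    singular⇒tightPair diag (σ , τ , (i , σi≢τi) , σ-min , τ-min) with σ ⟨$⟩ʳ i ≟ i
    ... | yes σi≡i = movedByMinimal⇒tightPair diag τ i (λ τi≡i → σi≢τi (trans σi≡i (sym τi≡i))) τ-min
    ... | no  σi≢i = movedByMinimal⇒tightPair diag σ i σi≢i σ-min

    -- For a tight pair {i,j}, the identity and the transposition (i j) are both minimal.
    tightPair⇒singular : IsSymmetric R M → DiagCondition R M → HasTightPair M → TropicallySingular R M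
    tightPair⇒singular symM diag (i , j , i≢j , tight) =
      Perm.id , τ , (i , subst (i ≢_) (sym (transpose-maps-i i j)) i≢j) ,
      ≤trace⇒attainsMin diag Perm.id (≤-reflexive permSum-id) ,
      ≤trace⇒attainsMin diag τ (tight⇒minimal τ τ-tight)
      where
      τ = transpose i j
      τ-tight : ∀ k → IsTightPair M k (τ ⟨$⟩ʳ k)
      τ-tight k with transpose-cases i j k
      ... | inj₁ (refl , τi≡j)        = subst (IsTightPair M i) (sym τi≡j) tight
      ... | inj₂ (inj₁ (refl , τj≡i)) = subst (IsTightPair M j) (sym τj≡i) (tightPair-sym symM tight)
      ... | inj₂ (inj₂ τk≡k)          = subst (IsTightPair M k) (sym τk≡k) ≤-refl

proposition6p1 : (R : RealField) → (M : Matrix3 R) → IsSymmetric R M →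
    (SymBarvinokRankAtMost R M 2 ⇔ DeficiencyGraph2Colorable R M) ×
    (DeficiencyGraph2Colorable R M ⇔ (TropicallySingular R M × DiagCondition R M))
proposition6p1 R M symM =
  mk⇔ rank≤2⇒colourable (colourable⇒rank≤2 symM) ,
  mk⇔ (λ C → tightPair⇒singular symM (diag C) (colourable⇒tightPair symM C) , diag C)
      (λ (singular , diag) →
         rank≤2⇒colourable (tightPair⇒rank≤2 symM diag (singular⇒tightPair diag singular)))
  where
  open SymmetricMatrices R
  diag : DeficiencyGraph2Colorable R M → DiagCondition R M
  diag = colourable⇒diag symM
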